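{- For all integers $a$ and $c$ and all nonnegative integers $b$, $$h(a,b,c)-h(a,b,c-1)=(y_{a+b+c-1}-y_c)\cdot h(a-1,b,c).$$
   Context: $R$ is the polynomial ring over $\mathbb{Z}$ in $x_1,x_2,\ldots,y_1,y_2,\ldots$; set $x_i=y_i=0$ for integers $i\le0$. For $a,c\in\mathbb{Z}$ and $b\in\mathbb{N}$, $h(a,b,c)=\sum_{(i_1,\ldots,i_a)\in[b]^a,\ i_1\le\cdots\le i_a}\prod_{j=1}^a(x_{i_j}+y_{i_j+(j-1)+c})$ with $[b]=\{1,\ldots,b\}$; this is $1$ when $a=0$ and is defined to be $0$ when $a<0$. -}

module Defs where

open import Algebra.Bundles using (CommutativeRing)
open import Data.Nat as ℕ using (ℕ; zero; suc; _∸_)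
open import Data.Integer as ℤ using (ℤ; +_; -[1+_])
open import Data.List using (List; []; _∷_; map; concatMap; upTo; foldr)

-- Weakly increasing sequences (i₁ ≤ ⋯ ≤ iₐ) of length a with entries in {lo,…,b}.
-- The index set of h is  incSeqs a 1 b  (all weakly increasing tuples in [b]^a).
incSeqs : ℕ → ℕ → ℕ → List (List ℕ)
incSeqs zero    lo b = [] ∷ []
incSeqs (suc a) lo b =
  concatMap (λ i → map (i ∷_) (incSeqs a i b)) (map (lo ℕ.+_) (upTo (suc b ∸ lo)))

-- Everything is stated in an arbitrary commutative ring R with arbitrary values
-- for the variables; by the universal property of the polynomial ring
-- ℤ[x₁,x₂,…,y₁,y₂,…] this is equivalent to the identity in that ring.
module HDefs {ℓ₁ ℓ₂} (R : CommutativeRing ℓ₁ ℓ₂) where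
  open CommutativeRing R

  -- variable with integer index, with the convention v_i = 0 for i ≤ 0;
  -- for n : ℕ, the variable v_{n+1} is  v n.
  var : (ℕ → Carrier) → ℤ → Carrier
  var v (+ zero)  = 0#
  var v (+ suc n) = v n
  var v -[1+ n ]  = 0#

  -- ∏_{j} (x_{i_j} + y_{i_j + (j-1) + c}), where the first element of the list
  -- has offset j-1 = k.
  prodTerm : (ℕ → Carrier) → (ℕ → Carrier) → ℤ → ℕ → List ℕ → Carrier
  prodTerm x y c k []       = 1#
  prodTerm x y c k (i ∷ is) =
    (var x (+ i) + var y ((+ i) ℤ.+ (+ k) ℤ.+ c)) * prodTerm x y c (suc k) is

  h : (ℕ → Carrier) → (ℕ → Carrier) → ℤ → ℕ → ℤ → Carrier
  h x y (+ a)    b c = foldr _+_ 0# (map (prodTerm x y c 0) (incSeqs a 1 b))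
  h x y -[1+ a ] b c = 0#

{-# OPTIONS --safe #-}
-- Generalise h to indices in {lo, …, lo+m−1} and an arbitrary sequence z in place of
-- y_{·+c}.  Splitting the sum according to whether i₁ = lo gives
--   h_{a+1}(lo, m+1; z) = (x_lo + z_lo) · h_a(lo, m+1; z ∘ suc) + h_{a+1}(lo+1, m; z),
-- and replacing c by c − 1 replaces z by a sequence w with w ∘ suc = z.  The identity
-- follows by induction on (a, m): the hypotheses for (a, lo, m+1) and (a+1, lo+1, m)
-- combine with this recursion by a ring identity.
module Submission where

open import Defs
open import Algebra.Bundles using (CommutativeRing)
open import Data.Nat as ℕ using (ℕ; zero; suc; _∸_; pred)
open import Data.Integer using (ℤ; +_)
import Data.Nat.Properties as ℕ
import Data.Integer as ℤ
open import Data.Integer.Tactic.RingSolver using (solve-∀)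
open import Data.List using (List; []; _∷_; _++_; map; concatMap; upTo; applyUpTo; foldr)
open import Data.List.Properties using (map-++; map-∘; map-cong; map-upTo)
open import Function using (_∘_)
open import Relation.Binary.PropositionalEquality as ≡ using (_≡_; cong)

upTo-suc-shift : ∀ lo n → map (lo ℕ.+_) (upTo (suc n)) ≡ lo ∷ map (suc lo ℕ.+_) (upTo n)
upTo-suc-shift lo n = ≡.cong₂ _∷_ (ℕ.+-identityʳ lo) (begin
    map (lo ℕ.+_) (applyUpTo suc n)        ≡⟨ cong (map (lo ℕ.+_)) (map-upTo suc n) ⟨
    map (lo ℕ.+_) (map suc (upTo n))       ≡⟨ map-∘ (upTo n) ⟨
    map (λ i → lo ℕ.+ suc i) (upTo n)     ≡⟨ map-cong (ℕ.+-suc lo) (upTo n) ⟩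
    map (suc lo ℕ.+_) (upTo n)             ∎)
  where open ≡.≡-Reasoning

[1+m]∸n≡1+o⇒m∸n≡o : ∀ m n {o} → suc m ∸ n ≡ suc o → m ∸ n ≡ o
[1+m]∸n≡1+o⇒m∸n≡o m n eq = ≡.trans (≡.sym (ℕ.pred[m∸n]≡m∸[1+n] (suc m) n)) (cong pred eq)

incSeqs-empty : ∀ a {lo b} → suc b ∸ lo ≡ 0 → incSeqs (suc a) lo b ≡ []
incSeqs-empty a {lo} {b} =
  cong (λ n → concatMap (λ i → map (i ∷_) (incSeqs a i b)) (map (lo ℕ.+_) (upTo n)))

incSeqs-split : ∀ a {lo b m} → suc b ∸ lo ≡ suc m →
  incSeqs (suc a) lo b ≡ map (lo ∷_) (incSeqs a lo b) ++ incSeqs (suc a) (suc lo) b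
incSeqs-split a {lo} {b} {m} b+1∸lo≡m+1 = begin
    concatMap g (map (lo ℕ.+_) (upTo (suc b ∸ lo)))
  ≡⟨ cong (concatMap g ∘ map (lo ℕ.+_) ∘ upTo) b+1∸lo≡m+1 ⟩
    concatMap g (map (lo ℕ.+_) (upTo (suc m)))
  ≡⟨ cong (concatMap g) (upTo-suc-shift lo m) ⟩
    g lo ++ concatMap g (map (suc lo ℕ.+_) (upTo m))
  ≡⟨ cong (λ n → g lo ++ concatMap g (map (suc lo ℕ.+_) (upTo n))) ([1+m]∸n≡1+o⇒m∸n≡o b lo b+1∸lo≡m+1) ⟨
    g lo ++ incSeqs (suc a) (suc lo) b
  ∎
  where
  open ≡.≡-Reasoning
  g : ℕ → List (List ℕ)
  g i = map (i ∷_) (incSeqs a i b)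

module WeaklyIncreasingSums {ℓ₁ ℓ₂} (R : CommutativeRing ℓ₁ ℓ₂) where
  open CommutativeRing R hiding (zero)
  open import Algebra.Properties.Group +-group using (∙-cancelʳ)
  open import Algebra.Solver.Ring.NaturalCoefficients.Default commutativeSemiring
    using (solve; _:+_; _:*_; _:=_)
  open import Relation.Binary.Reasoning.Setoid setoid

  ∑ : List Carrier → Carrier
  ∑ = foldr _+_ 0#

  ∑-++ : ∀ xs ys → ∑ (xs ++ ys) ≈ ∑ xs + ∑ ys
  ∑-++ []       ys = sym (+-identityˡ (∑ ys))
  ∑-++ (x ∷ xs) ys = trans (+-congˡ (∑-++ xs ys)) (sym (+-assoc x (∑ xs) (∑ ys)))

  ∑-map-*ˡ : ∀ {a} {A : Set a} u (f : A → Carrier) xs → ∑ (map (λ l → u * f l) xs) ≈ u * ∑ (map f xs)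
  ∑-map-*ˡ u f []       = sym (zeroʳ u)
  ∑-map-*ˡ u f (l ∷ xs) = trans (+-congˡ (∑-map-*ˡ u f xs)) (sym (distribˡ u (f l) (∑ (map f xs))))

  move-to-difference : ∀ {u u′ p q g} → u + p * g ≈ u′ + q * g → u - u′ ≈ (q - p) * g
  move-to-difference {u} {u′} {p} {q} {g} eq = ∙-cancelʳ (u′ + p * g) _ _ (begin
      (u - u′) + (u′ + p * g)        ≈⟨ regroup₁ u (- u′) u′ (p * g) ⟩
      (u + p * g) + (u′ - u′)        ≈⟨ +-cong eq (-‿inverseʳ u′) ⟩
      (u′ + q * g) + 0#              ≈⟨ +-congˡ (trans (*-congʳ (-‿inverseʳ p)) (zeroˡ g)) ⟨
      (u′ + q * g) + (p - p) * g     ≈⟨ regroup₂ u′ q p (- p) g ⟩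
      (q - p) * g + (u′ + p * g)     ∎)
    where
    regroup₁ : ∀ u v u′ w → (u + v) + (u′ + w) ≈ (u + w) + (u′ + v)
    regroup₁ = solve 4 (λ u v u′ w → (u :+ v) :+ (u′ :+ w) := (u :+ w) :+ (u′ :+ v)) refl
    regroup₂ : ∀ u′ q p v g → (u′ + q * g) + (p + v) * g ≈ (q + v) * g + (u′ + p * g)
    regroup₂ = solve 5 (λ u′ q p v g → (u′ :+ q :* g) :+ (p :+ v) :* g := (q :+ v) :* g :+ (u′ :+ p :* g)) refl

  first-factor-shift : ∀ {x y₀ y₋ e A B C W T₁ T₂} →
    B ≈ (x + y₀) * C + W → A + y₀ * C ≈ B + e * C → T₁ + y₀ * W ≈ T₂ + e * W →
    ((x + y₀) * A + T₁) + y₋ * B ≈ ((x + y₋) * B + T₂) + e * B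
  first-factor-shift {x} {y₀} {y₋} {e} {A} {B} {C} {W} {T₁} {T₂} B≈ A≈ T≈ =
    ∙-cancelʳ (y₀ * B) _ _ (begin
      ((x + y₀) * A + T₁) + y₋ * B + y₀ * B                  ≈⟨ +-congˡ (*-congˡ B≈) ⟩
      ((x + y₀) * A + T₁) + y₋ * B + y₀ * ((x + y₀) * C + W)  ≈⟨ regroup₁ x y₀ y₋ A B C W T₁ ⟩
      (x + y₀) * (A + y₀ * C) + (T₁ + y₀ * W) + y₋ * B        ≈⟨ +-congʳ (+-cong (*-congˡ A≈) T≈) ⟩
      (x + y₀) * (B + e * C) + (T₂ + e * W) + y₋ * B          ≈⟨ regroup₂ x y₀ y₋ e B C W T₂ ⟩
      ((x + y₋) * B + T₂) + e * ((x + y₀) * C + W) + y₀ * B   ≈⟨ +-congʳ (+-congˡ (*-congˡ B≈)) ⟨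
      ((x + y₋) * B + T₂) + e * B + y₀ * B                    ∎)
    where
    regroup₁ : ∀ x y₀ y₋ A B C W T₁ →
      ((x + y₀) * A + T₁) + y₋ * B + y₀ * ((x + y₀) * C + W) ≈ (x + y₀) * (A + y₀ * C) + (T₁ + y₀ * W) + y₋ * B
    regroup₁ = solve 8 (λ x y₀ y₋ A B C W T₁ →
      ((x :+ y₀) :* A :+ T₁) :+ y₋ :* B :+ y₀ :* ((x :+ y₀) :* C :+ W)
        := (x :+ y₀) :* (A :+ y₀ :* C) :+ (T₁ :+ y₀ :* W) :+ y₋ :* B) refl
    regroup₂ : ∀ x y₀ y₋ e B C W T₂ →
      (x + y₀) * (B + e * C) + (T₂ + e * W) + y₋ * B ≈ ((x + y₋) * B + T₂) + e * ((x + y₀) * C + W) + y₀ * B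
    regroup₂ = solve 8 (λ x y₀ y₋ e B C W T₂ →
      (x :+ y₀) :* (B :+ e :* C) :+ (T₂ :+ e :* W) :+ y₋ :* B
        := ((x :+ y₋) :* B :+ T₂) :+ e :* ((x :+ y₀) :* C :+ W) :+ y₀ :* B) refl

  module _ (ξ : ℕ → Carrier) where

    -- hSum a lo m z = Σ ∏ⱼ (ξ iⱼ + z (iⱼ + j − 1)) over lo ≤ i₁ ≤ ⋯ ≤ iₐ ≤ lo + m − 1.
    hSum : ℕ → ℕ → ℕ → (ℕ → Carrier) → Carrier
    hSum zero    lo m       z = 1#
    hSum (suc a) lo zero    z = 0#
    hSum (suc a) lo (suc m) z = (ξ lo + z lo) * hSum a lo (suc m) (z ∘ suc) + hSum (suc a) (suc lo) m z

    hSum-cong : ∀ a lo m {z z′} → (∀ i → z i ≈ z′ i) → hSum a lo m z ≈ hSum a lo m z′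
    hSum-cong zero    lo m       z≈z′ = refl
    hSum-cong (suc a) lo zero    z≈z′ = refl
    hSum-cong (suc a) lo (suc m) z≈z′ =
      +-cong (*-cong (+-congˡ (z≈z′ lo)) (hSum-cong a lo (suc m) (z≈z′ ∘ suc)))
             (hSum-cong (suc a) (suc lo) m z≈z′)

    hSum-shift-tail : ∀ a lo m {z w} → (∀ i → w (suc i) ≈ z i) →
      hSum (suc a) (suc lo) m z + z lo * hSum a (suc lo) m z
        ≈ hSum (suc a) (suc lo) m w + w (a ℕ.+ lo ℕ.+ suc m) * hSum a (suc lo) m z

    -- The difference identity with both sides moved so that no subtraction occurs;
    -- w plays the role of y_{·+c−1} when z is y_{·+c}.
    hSum-shift : ∀ a lo m {z w} → (∀ i → w (suc i) ≈ z i) →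
      hSum (suc a) lo m z + w lo * hSum a lo m z ≈ hSum (suc a) lo m w + w (a ℕ.+ lo ℕ.+ m) * hSum a lo m z
    hSum-shift zero lo zero {w = w} _ =
      +-congˡ (*-congʳ (reflexive (cong w (≡.sym (ℕ.+-identityʳ lo)))))
    hSum-shift (suc a) lo zero _ = +-congˡ (trans (zeroʳ _) (sym (zeroʳ _)))
    hSum-shift zero lo (suc m) w∘suc≈z =
      first-factor-shift (sym (trans (+-congʳ (zeroʳ _)) (+-identityˡ 1#)))
        (+-congˡ (trans (zeroʳ _) (sym (zeroʳ _))))
        (hSum-shift-tail zero lo m w∘suc≈z)
    hSum-shift (suc a) lo (suc m) {z} {w} w∘suc≈z =
      trans (+-congˡ (*-congˡ (sym B≈D)))
        (trans (first-factor-shift B≈D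
                 (trans (+-congˡ (*-congʳ (sym (w∘suc≈z lo)))) (hSum-shift a lo (suc m) (w∘suc≈z ∘ suc)))
                 (hSum-shift-tail (suc a) lo m w∘suc≈z))
          (+-congˡ (*-congˡ B≈D)))
      where
      B≈D : hSum (suc a) lo (suc m) (w ∘ suc) ≈ hSum (suc a) lo (suc m) z
      B≈D = hSum-cong (suc a) lo (suc m) w∘suc≈z

    hSum-shift-tail a lo m {w = w} w∘suc≈z =
      trans (+-congˡ (*-congʳ (sym (w∘suc≈z lo))))
        (trans (hSum-shift a (suc lo) m w∘suc≈z)
          (+-congˡ (*-congʳ (reflexive (cong w (index-shift a lo m))))))
      where
      index-shift : ∀ n lo m → n ℕ.+ suc lo ℕ.+ m ≡ n ℕ.+ lo ℕ.+ suc m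
      index-shift n lo m = ≡.trans (cong (ℕ._+ m) (ℕ.+-suc n lo)) (≡.sym (ℕ.+-suc (n ℕ.+ lo) m))

module HIdentity {ℓ₁ ℓ₂} (R : CommutativeRing ℓ₁ ℓ₂) (x y : ℕ → CommutativeRing.Carrier R) where
  open CommutativeRing R hiding (zero)
  open HDefs R
  open WeaklyIncreasingSums R
  open import Relation.Binary.Reasoning.Setoid setoid

  yFrom : ℤ → ℕ → ℕ → Carrier
  yFrom c k i = var y (+ i ℤ.+ + k ℤ.+ c)

  sum-incSeqs : ∀ b c a lo m k → suc b ∸ lo ≡ m →
    ∑ (map (prodTerm x y c k) (incSeqs a lo b)) ≈ hSum (var x ∘ +_) a lo m (yFrom c k)
  sum-incSeqs b c zero lo m k _ = +-identityʳ 1#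
  sum-incSeqs b c (suc a) lo zero k b+1∸lo≡0 =
    reflexive (cong (∑ ∘ map (prodTerm x y c k)) (incSeqs-empty a {lo} {b} b+1∸lo≡0))
  sum-incSeqs b c (suc a) lo (suc m) k b+1∸lo≡m+1 = begin
      ∑ (map P (incSeqs (suc a) lo b))
    ≡⟨ cong (∑ ∘ map P) (incSeqs-split a {lo} {b} b+1∸lo≡m+1) ⟩
      ∑ (map P (map (lo ∷_) (incSeqs a lo b) ++ incSeqs (suc a) (suc lo) b))
    ≡⟨ cong ∑ (map-++ P (map (lo ∷_) (incSeqs a lo b)) (incSeqs (suc a) (suc lo) b)) ⟩
      ∑ (map P (map (lo ∷_) (incSeqs a lo b)) ++ map P (incSeqs (suc a) (suc lo) b))
    ≈⟨ ∑-++ (map P (map (lo ∷_) (incSeqs a lo b))) (map P (incSeqs (suc a) (suc lo) b)) ⟩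
      ∑ (map P (map (lo ∷_) (incSeqs a lo b))) + ∑ (map P (incSeqs (suc a) (suc lo) b))
    ≡⟨ cong (λ L → ∑ L + ∑ (map P (incSeqs (suc a) (suc lo) b))) (map-∘ (incSeqs a lo b)) ⟨
      ∑ (map (λ l → u * prodTerm x y c (suc k) l) (incSeqs a lo b)) + ∑ (map P (incSeqs (suc a) (suc lo) b))
    ≈⟨ +-congʳ (∑-map-*ˡ u (prodTerm x y c (suc k)) (incSeqs a lo b)) ⟩
      u * ∑ (map (prodTerm x y c (suc k)) (incSeqs a lo b)) + ∑ (map P (incSeqs (suc a) (suc lo) b))
    ≈⟨ +-cong (*-congˡ (trans (sum-incSeqs b c a lo (suc m) (suc k) b+1∸lo≡m+1)
                             (hSum-cong (var x ∘ +_) a lo (suc m) yFrom-suc)))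
              (sum-incSeqs b c (suc a) (suc lo) m k ([1+m]∸n≡1+o⇒m∸n≡o b lo b+1∸lo≡m+1)) ⟩
      hSum (var x ∘ +_) (suc a) lo (suc m) (yFrom c k)
    ∎
    where
    P : List ℕ → Carrier
    P = prodTerm x y c k
    u : Carrier
    u = var x (+ lo) + yFrom c k lo
    yFrom-suc : ∀ i → yFrom c (suc k) i ≈ yFrom c k (suc i)
    yFrom-suc i = reflexive (cong (λ n → var y (+ n ℤ.+ c)) (ℕ.+-suc i k))

  h≈hSum : ∀ b c a → h x y (+ a) b c ≈ hSum (var x ∘ +_) a 1 b (yFrom c 0)
  h≈hSum b c a = sum-incSeqs b c a 1 b 0 ≡.refl

  h-suc-difference : ∀ n b c →
    h x y (+ suc n) b c - h x y (+ suc n) b (c ℤ.- + 1)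
      ≈ (var y (+ suc n ℤ.+ + b ℤ.+ c ℤ.- + 1) - var y c) * h x y (+ n) b c
  h-suc-difference n b c = begin
      h x y (+ suc n) b c - h x y (+ suc n) b (c ℤ.- + 1)
    ≈⟨ +-cong (h≈hSum b c (suc n)) (-‿cong (h≈hSum b (c ℤ.- + 1) (suc n))) ⟩
      hSum (var x ∘ +_) (suc n) 1 b z - hSum (var x ∘ +_) (suc n) 1 b w
    ≈⟨ move-to-difference (hSum-shift (var x ∘ +_) n 1 b w∘suc≈z) ⟩
      (w (n ℕ.+ 1 ℕ.+ b) - w 1) * hSum (var x ∘ +_) n 1 b z
    ≈⟨ *-cong (+-cong last-index (-‿cong first-index)) (sym (h≈hSum b c n)) ⟩
      (var y (+ suc n ℤ.+ + b ℤ.+ c ℤ.- + 1) - var y c) * h x y (+ n) b c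
    ∎
    where
    z w : ℕ → Carrier
    z = yFrom c 0
    w = yFrom (c ℤ.- + 1) 0
    shift-index : ∀ i c → + 1 ℤ.+ i ℤ.+ + 0 ℤ.+ (c ℤ.- + 1) ≡ i ℤ.+ + 0 ℤ.+ c
    shift-index = solve-∀
    first-index-eq : ∀ c → + 1 ℤ.+ + 0 ℤ.+ (c ℤ.- + 1) ≡ c
    first-index-eq = solve-∀
    last-index-eq : ∀ i c → i ℤ.+ + 0 ℤ.+ (c ℤ.- + 1) ≡ i ℤ.+ c ℤ.- + 1
    last-index-eq = solve-∀
    w∘suc≈z : ∀ i → w (suc i) ≈ z i
    w∘suc≈z i = reflexive (cong (var y) (shift-index (+ i) c))
    first-index : w 1 ≈ var y c
    first-index = reflexive (cong (var y) (first-index-eq c))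
    last-index : w (n ℕ.+ 1 ℕ.+ b) ≈ var y (+ suc n ℤ.+ + b ℤ.+ c ℤ.- + 1)
    last-index = reflexive (cong (var y) (≡.trans
      (cong (λ i → + i ℤ.+ + 0 ℤ.+ (c ℤ.- + 1)) (cong (ℕ._+ b) (ℕ.+-comm n 1)))
      (last-index-eq (+ suc n ℤ.+ + b) c)))

open import Data.Integer using (_+_; _-_; -[1+_])

lemma7p6 : ∀ {ℓ₁ ℓ₂} (R : CommutativeRing ℓ₁ ℓ₂) (x y : ℕ → CommutativeRing.Carrier R)
    (a : ℤ) (b : ℕ) (c : ℤ) →
    CommutativeRing._≈_ R
      (CommutativeRing._-_ R (HDefs.h R x y a b c) (HDefs.h R x y a b (c - + 1)))
      (CommutativeRing._*_ R
        (CommutativeRing._-_ R (HDefs.var R y (a + + b + c - + 1)) (HDefs.var R y c))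
        (HDefs.h R x y (a - + 1) b c))
lemma7p6 R x y (+ suc n) b c = HIdentity.h-suc-difference R x y n b c
lemma7p6 R x y (+ zero)  b c = trans (-‿inverseʳ _) (sym (zeroʳ _))
  where open CommutativeRing R using (trans; sym; -‿inverseʳ; zeroʳ)
lemma7p6 R x y -[1+ n ]  b c = trans (-‿inverseʳ _) (sym (zeroʳ _))
  where open CommutativeRing R using (trans; sym; -‿inverseʳ; zeroʳ)
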